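{- Let $n \in \mathbb{Z}_{\geq 0}$ and $k \in \mathbb{Z}_{>0}$. Let $\sigma$ be the factoradic form of $n$, and let $\mathrm{inv}(i,j)$ for $0\le i<j\le k-1$ be the inversion set of the $k$-prefix of $\sigma$. Then $$n \equiv \sum_{0\le i<j\le k-1} \mathrm{inv}(i,j)\cdot j! \pmod{k}.$$
   Context: A permutation $\sigma$ of $\mathbb{Z}_{\geq 0}$ is called tame if $\sigma(i)=i$ for all but finitely many $i$; it is written as the sequence $(\sigma(0),\sigma(1),\sigma(2),\dots)$. The factoradic order on tame permutations is defined as follows: for distinct tame $\sigma,\tau$, let $p$ be the largest index with $\sigma(p)\neq\tau(p)$; then $\sigma$ precedes $\tau$ if and only if $\sigma(p)>\tau(p)$ (i.e. the inverse of the right-to-left lexicographic order). This is a linear order isomorphic to $(\mathbb{Z}_{\geq 0},<)$, and the factoradic form of $n\in\mathbb{Z}_{\geq0}$ is the $n$-th tame permutation in this order, counting from $0$ (so $0$ corresponds to the identity $(0,1,2,\dots)$, $1$ to $(1,0,2,\dots)$, $2$ to $(0,2,1,\dots)$, $3$ to $(2,0,1,\dots)$, $4$ to $(1,2,0,\dots)$). For $s\ge 0$, the $s$-prefix of a tame permutation $\sigma$ is the finite sequence $(\sigma(0),\dots,\sigma(s-1))$. The inversion set of the $s$-prefix is the function on pairs $0\le i<j\le s-1$ given by $\mathrm{inv}(i,j)=1$ if $\sigma(i)>\sigma(j)$ and $\mathrm{inv}(i,j)=0$ otherwise. -}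

module Defs where

open import Data.Nat using (ℕ; zero; suc; _+_; _*_; _≤_; _<_; _>_; _<ᵇ_; _!)
open import Data.List using (List; map; upTo)
open import Data.Nat.ListAction using (sum)
open import Data.Bool using (if_then_else_)
open import Data.Product using (Σ; ∃; _×_)
open import Data.Fin using (Fin)
open import Relation.Binary.PropositionalEquality using (_≡_)
open import Relation.Nullary using (¬_)

IsPerm : (ℕ → ℕ) → Set
IsPerm σ = (∀ {i j} → σ i ≡ σ j → i ≡ j) × (∀ m → ∃ λ i → σ i ≡ m)

IsTame : (ℕ → ℕ) → Set
IsTame σ = IsPerm σ × (∃ λ N → ∀ i → N ≤ i → σ i ≡ i)

_≐_ : (ℕ → ℕ) → (ℕ → ℕ) → Set
σ ≐ τ = ∀ i → σ i ≡ τ i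

_≺_ : (ℕ → ℕ) → (ℕ → ℕ) → Set
σ ≺ τ = ∃ λ p → (σ p > τ p) × (∀ q → p < q → σ q ≡ τ q)

-- σ is the factoradic form of n: σ is tame and exactly n tame permutations
-- precede σ (counted up to equality of permutations), i.e. σ is the n-th
-- tame permutation in the factoradic order, counting from 0.
-- Concretely: there is an enumeration f : Fin n → (ℕ → ℕ) of tame
-- permutations preceding σ, injective and surjective up to ≐.
IsFactoradicFormOf : (ℕ → ℕ) → ℕ → Set
IsFactoradicFormOf σ n =
  IsTame σ ×
  (Σ (Fin n → (ℕ → ℕ)) λ f →
      (∀ a → IsTame (f a) × (f a ≺ σ))
    × (∀ a b → f a ≐ f b → a ≡ b)
    × (∀ τ → IsTame τ → τ ≺ σ → ∃ λ a → f a ≐ τ))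

inv : (ℕ → ℕ) → ℕ → ℕ → ℕ
inv σ i j = if σ j <ᵇ σ i then 1 else 0

invSum : (ℕ → ℕ) → ℕ → ℕ
invSum σ k = sum (map (λ j → sum (map (λ i → inv σ i j * (j !)) (upTo j))) (upTo k))

-- Read the inversion counts lehmer σ j = #{i < j : σ i > σ j} as the digits of a
-- factorial-base numeral rank σ N = Σ_{j<N} lehmer σ j · j!.  On permutations
-- supported below N this is a strictly increasing map for the factoradic order
-- (the largest differing position decides, exactly as for the digits), and every
-- m < N! is attained by inserting the values one position at a time.  Counting
-- the predecessors of σ in both directions therefore gives n = rank σ N for all
-- large N, and since k ∣ j! for j ≥ k, reducing modulo k leaves only the digits
-- with j < k, which is the inversion sum of the k-prefix.
module Submission where

open import Defs
open import Data.Bool using (true; false; if_then_else_)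
open import Data.Empty using (⊥-elim)
open import Data.Fin using (Fin; toℕ; fromℕ<)
open import Data.Fin.Properties using (toℕ<n; toℕ-fromℕ<; toℕ-injective; injective⇒≤)
open import Data.List using (List; []; _∷_; _++_; map; upTo; length)
open import Data.List.Membership.Propositional using (_∈_)
open import Data.List.Membership.Propositional.Properties
  using (∈-∃++; ∈-++⁻; ∈-++⁺ˡ; ∈-++⁺ʳ; ∈-map⁻; ∈-map⁺; ∈-upTo⁺; ∈-upTo⁻)
open import Data.List.Properties using (upTo-∷ʳ; map-++; map-∘; map-cong; map-cong-local; length-map; length-upTo)
open import Data.List.Relation.Binary.Permutation.Propositional using (_↭_; ↭-refl; ↭-prep; ↭-trans; ↭-sym)
open import Data.List.Relation.Binary.Permutation.Propositional.Properties using (shift; map⁺; ↭-length)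
open import Data.List.Relation.Binary.Subset.Propositional using (_⊆_)
open import Data.List.Relation.Unary.All as All using ()
open import Data.List.Relation.Unary.AllPairs using (_∷_)
open import Data.List.Relation.Unary.Any using (here; there)
open import Data.List.Relation.Unary.Unique.Propositional using (Unique)
import Data.List.Relation.Unary.Unique.Propositional.Properties as Unique
open import Data.Nat
open import Data.Nat.Divisibility using (_∣_; ∣-trans; m∣m*n; n∣m*n; m≤n⇒m!∣n!)
open import Data.Nat.DivMod using (_%_; _/_; %-remove-+ʳ; m%n<n; m≡m%n+[m/n]*n; m<n*o⇒m/o<n)
open import Data.Nat.ListAction using (sum)
open import Data.Nat.ListAction.Properties using (sum-++; sum-↭)
open import Data.Nat.Properties
open import Data.Product using (∃; _×_; _,_; proj₁; proj₂)
open import Data.Sum using (_⊎_; inj₁; inj₂)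
open import Function using (_∘_; id)
open import Function.Definitions using (Injective)
open import Relation.Binary using (tri<; tri≈; tri>; _Preserves_⟶_)
open import Relation.Binary.PropositionalEquality
open import Relation.Nullary using (yes; no)

∑< : ℕ → (ℕ → ℕ) → ℕ
∑< k f = sum (map f (upTo k))

syntax ∑< k (λ i → e) = ∑[ i < k ] e

∑-suc : ∀ k f → ∑< (suc k) f ≡ ∑< k f + f k
∑-suc k f = begin
  sum (map f (upTo (suc k)))        ≡⟨ cong (sum ∘ map f) (upTo-∷ʳ k) ⟨
  sum (map f (upTo k ++ k ∷ []))    ≡⟨ cong sum (map-++ f (upTo k) (k ∷ [])) ⟩
  sum (map f (upTo k) ++ f k ∷ [])  ≡⟨ sum-++ (map f (upTo k)) (f k ∷ []) ⟩
  ∑< k f + (f k + 0)                ≡⟨ cong (∑< k f +_) (+-identityʳ (f k)) ⟩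
  ∑< k f + f k                      ∎
  where open ≡-Reasoning

∑-cong : ∀ k {f g} → (∀ i → i < k → f i ≡ g i) → ∑< k f ≡ ∑< k g
∑-cong k f≗g = cong sum (map-cong-local (All.tabulate (λ i∈ → f≗g _ (∈-upTo⁻ i∈))))

sum-map-*ʳ : ∀ (f : ℕ → ℕ) a xs → sum (map (λ x → f x * a) xs) ≡ sum (map f xs) * a
sum-map-*ʳ f a []       = refl
sum-map-*ʳ f a (x ∷ xs) =
  trans (cong (f x * a +_) (sum-map-*ʳ f a xs)) (sym (*-distribʳ-+ a (f x) (sum (map f xs))))

sum-map-mono-≤ : ∀ {f g : ℕ → ℕ} → (∀ x → f x ≤ g x) → ∀ xs → sum (map f xs) ≤ sum (map g xs)
sum-map-mono-≤ f≤g []       = z≤n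
sum-map-mono-≤ f≤g (x ∷ xs) = +-mono-≤ (f≤g x) (sum-map-mono-≤ f≤g xs)

sum-map-≤-length : ∀ {f : ℕ → ℕ} → (∀ x → f x ≤ 1) → ∀ xs → sum (map f xs) ≤ length xs
sum-map-≤-length f≤1 []       = z≤n
sum-map-≤-length f≤1 (x ∷ xs) = +-mono-≤ (f≤1 x) (sum-map-≤-length f≤1 xs)

⊆∧length≡⇒↭ : ∀ {A : Set} {xs ys : List A} → Unique xs → xs ⊆ ys → length xs ≡ length ys → xs ↭ ys
⊆∧length≡⇒↭ {xs = []}     {[]}    _              _     _   = ↭-refl
⊆∧length≡⇒↭ {xs = x ∷ xs} (x∉xs ∷ xs!) xs⊆ys len with ∈-∃++ (xs⊆ys (here refl))
... | as , bs , refl = ↭-trans (↭-prep x (⊆∧length≡⇒↭ xs! xs⊆as++bs len′)) (↭-sym (shift x as bs))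
  where
  xs⊆as++bs : xs ⊆ as ++ bs
  xs⊆as++bs z∈xs with ∈-++⁻ as (xs⊆ys (there z∈xs))
  ... | inj₁ z∈as         = ∈-++⁺ˡ z∈as
  ... | inj₂ (here refl)  = ⊥-elim (All.lookup x∉xs z∈xs refl)
  ... | inj₂ (there z∈bs) = ∈-++⁺ʳ as z∈bs
  len′ : length xs ≡ length (as ++ bs)
  len′ = suc-injective (trans len (↭-length (shift x as bs)))

∑-reindex : ∀ m g {π ρ : ℕ → ℕ} → Injective _≡_ _≡_ π →
            (∀ i → i < m → ∃ λ i′ → i′ < m × ρ i′ ≡ π i) →
            ∑[ i < m ] g (π i) ≡ ∑[ i < m ] g (ρ i)
∑-reindex m g {π} {ρ} π-inj π⊆ρ = begin
  sum (map (g ∘ π) (upTo m))    ≡⟨ cong sum (map-∘ (upTo m)) ⟩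
  sum (map g (map π (upTo m)))  ≡⟨ sum-↭ (map⁺ g (⊆∧length≡⇒↭ π-unique image⊆ length≡)) ⟩
  sum (map g (map ρ (upTo m)))  ≡⟨ cong sum (map-∘ (upTo m)) ⟨
  sum (map (g ∘ ρ) (upTo m))    ∎
  where
  open ≡-Reasoning
  π-unique : Unique (map π (upTo m))
  π-unique = Unique.map⁺ π-inj (Unique.upTo⁺ m)
  image⊆ : map π (upTo m) ⊆ map ρ (upTo m)
  image⊆ y∈ with ∈-map⁻ π y∈
  ... | i , i∈ , refl with π⊆ρ i (∈-upTo⁻ i∈)
  ... | i′ , i′<m , ρi′≡πi = subst (_∈ map ρ (upTo m)) ρi′≡πi (∈-map⁺ ρ (∈-upTo⁺ i′<m))
  length≡ : length (map π (upTo m)) ≡ length (map ρ (upTo m))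
  length≡ = trans (length-map π (upTo m)) (sym (length-map ρ (upTo m)))

<ᵇ-true : ∀ {m n} → m < n → (m <ᵇ n) ≡ true
<ᵇ-true {zero}  {suc n} _         = refl
<ᵇ-true {suc m} {suc n} (s≤s m<n) = <ᵇ-true m<n

<ᵇ-false : ∀ {m n} → n ≤ m → (m <ᵇ n) ≡ false
<ᵇ-false {m}     {zero}  _         = refl
<ᵇ-false {suc m} {suc n} (s≤s n≤m) = <ᵇ-false n≤m

𝟙[_<_] : ℕ → ℕ → ℕ
𝟙[ m < n ] = if m <ᵇ n then 1 else 0

𝟙[<]-yes : ∀ {m n} → m < n → 𝟙[ m < n ] ≡ 1
𝟙[<]-yes m<n rewrite <ᵇ-true m<n = refl

𝟙[<]-no : ∀ {m n} → n ≤ m → 𝟙[ m < n ] ≡ 0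
𝟙[<]-no n≤m rewrite <ᵇ-false n≤m = refl

𝟙[<]≤1 : ∀ m n → 𝟙[ m < n ] ≤ 1
𝟙[<]≤1 m n with m <ᵇ n
... | true  = ≤-refl
... | false = z≤n

𝟙[<]-antitoneˡ : ∀ {a b} x → a ≤ b → 𝟙[ b < x ] ≤ 𝟙[ a < x ]
𝟙[<]-antitoneˡ {a} {b} x a≤b with b <? x
... | yes b<x rewrite 𝟙[<]-yes b<x | 𝟙[<]-yes (≤-<-trans a≤b b<x) = ≤-refl
... | no  b≮x rewrite 𝟙[<]-no (≮⇒≥ b≮x) = z≤n

distinct⇒injective : ∀ {f : ℕ → ℕ} → (∀ {i j} → i < j → f i ≢ f j) → Injective _≡_ _≡_ f
distinct⇒injective distinct {i} {j} fi≡fj with <-cmp i j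
... | tri< i<j _ _ = ⊥-elim (distinct i<j fi≡fj)
... | tri≈ _ i≡j _ = i≡j
... | tri> _ _ j<i = ⊥-elim (distinct j<i (sym fi≡fj))

module _ {f : ℕ → ℕ} (f-mono : f Preserves _<_ ⟶ _<_) where

  strictMono-injective : Injective _≡_ _≡_ f
  strictMono-injective = distinct⇒injective (<⇒≢ ∘ f-mono)

  strictMono-reflects-< : ∀ {a b} → f a < f b → a < b
  strictMono-reflects-< {a} {b} fa<fb with <-cmp a b
  ... | tri< a<b _ _ = a<b
  ... | tri≈ _ refl _ = ⊥-elim (<-irrefl refl fa<fb)
  ... | tri> _ _ b<a = ⊥-elim (<-asym fa<fb (f-mono b<a))

  𝟙[<]-strictMono : ∀ a b → 𝟙[ f a < f b ] ≡ 𝟙[ a < b ]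
  𝟙[<]-strictMono a b with a <? b
  ... | yes a<b = trans (𝟙[<]-yes (f-mono a<b)) (sym (𝟙[<]-yes a<b))
  ... | no  a≮b = trans (𝟙[<]-no (≮⇒≥ (a≮b ∘ strictMono-reflects-<))) (sym (𝟙[<]-no (≮⇒≥ a≮b)))

AgreeFrom : ℕ → (ℕ → ℕ) → (ℕ → ℕ) → Set
AgreeFrom m τ ρ = ∀ q → m ≤ q → τ q ≡ ρ q

Onto : (ℕ → ℕ) → Set
Onto π = ∀ y → ∃ λ i → π i ≡ y

FixesFrom : ℕ → (ℕ → ℕ) → Set
FixesFrom N π = AgreeFrom N π id

IsPermBelow : ℕ → (ℕ → ℕ) → Set
IsPermBelow N π = IsPerm π × FixesFrom N π

agreeFrom⇒image⊆ : ∀ {m τ ρ} → Injective _≡_ _≡_ τ → Onto ρ → AgreeFrom m τ ρ →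
                   ∀ i → i < m → ∃ λ i′ → i′ < m × ρ i′ ≡ τ i
agreeFrom⇒image⊆ {m} {τ} τ-inj ρ-onto τ≡ρ i i<m with ρ-onto (τ i)
... | i′ , ρi′≡τi with i′ <? m
... | yes i′<m = i′ , i′<m , ρi′≡τi
... | no  i′≮m = ⊥-elim (<⇒≱ i<m (subst (m ≤_) (τ-inj (trans (τ≡ρ i′ m≤i′) ρi′≡τi)) m≤i′))
  where m≤i′ = ≮⇒≥ i′≮m

permBelow-< : ∀ {N π} → Injective _≡_ _≡_ π → FixesFrom N π → ∀ i → i < N → π i < N
permBelow-< π-inj π-fix i i<N with agreeFrom⇒image⊆ π-inj (λ y → y , refl) π-fix i i<N
... | i′ , i′<N , refl = i′<N

permBelow-preimage : ∀ {N π} → IsPerm π → FixesFrom N π → ∀ y → y < N → ∃ λ i → i < N × π i ≡ y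
permBelow-preimage (_ , π-onto) π-fix = agreeFrom⇒image⊆ id π-onto (λ q N≤q → sym (π-fix q N≤q))

skip : ℕ → ℕ → ℕ
skip v x = if x <ᵇ v then x else suc x

skip-< : ∀ {v x} → x < v → skip v x ≡ x
skip-< x<v rewrite <ᵇ-true x<v = refl

skip-≥ : ∀ {v x} → v ≤ x → skip v x ≡ suc x
skip-≥ v≤x rewrite <ᵇ-false v≤x = refl

skip-≤ : ∀ v x → skip v x ≤ suc x
skip-≤ v x with x <? v
... | yes x<v rewrite skip-< x<v = n≤1+n x
... | no  x≮v rewrite skip-≥ (≮⇒≥ x≮v) = ≤-refl

skip-≢ : ∀ v x → skip v x ≢ v
skip-≢ v x with x <? v
... | yes x<v rewrite skip-< x<v = <⇒≢ x<v
... | no  x≮v rewrite skip-≥ (≮⇒≥ x≮v) = ≢-sym (<⇒≢ (s≤s (≮⇒≥ x≮v)))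

skip-strictMono : ∀ v → skip v Preserves _<_ ⟶ _<_
skip-strictMono v {a} {b} a<b with a <? v | b <? v
... | yes a<v | yes b<v rewrite skip-< a<v | skip-< b<v = a<b
... | yes a<v | no  b≮v rewrite skip-< a<v | skip-≥ (≮⇒≥ b≮v) = m<n⇒m<1+n a<b
... | no  a≮v | yes b<v = ⊥-elim (a≮v (<-trans a<b b<v))
... | no  a≮v | no  b≮v rewrite skip-≥ (≮⇒≥ a≮v) | skip-≥ (≮⇒≥ b≮v) = s≤s a<b

∑-𝟙[<skip] : ∀ v N → ∑[ x < N ] 𝟙[ v < skip v x ] ≡ N ∸ v
∑-𝟙[<skip] v zero = sym (0∸n≡0 v)
∑-𝟙[<skip] v (suc N) rewrite ∑-suc N (λ x → 𝟙[ v < skip v x ]) | ∑-𝟙[<skip] v N with N <? v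
... | yes N<v rewrite skip-< N<v | 𝟙[<]-no (<⇒≤ N<v) | m≤n⇒m∸n≡0 (<⇒≤ N<v) | m≤n⇒m∸n≡0 N<v = refl
... | no  N≮v rewrite skip-≥ (≮⇒≥ N≮v) | 𝟙[<]-yes (s≤s (≮⇒≥ N≮v)) =
  trans (sym (+-∸-comm 1 (≮⇒≥ N≮v))) (cong (_∸ v) (+-comm N 1))

extend : (ℕ → ℕ) → ℕ → ℕ → ℕ → ℕ
extend π N v i = if i <ᵇ N then skip v (π i) else if N <ᵇ i then i else v

extend-< : ∀ π {N} v {i} → i < N → extend π N v i ≡ skip v (π i)
extend-< π v i<N rewrite <ᵇ-true i<N = refl

extend-last : ∀ π N v → extend π N v N ≡ v
extend-last π N v rewrite <ᵇ-false (≤-refl {N}) = refl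

extend-> : ∀ π {N} v {i} → N < i → extend π N v i ≡ i
extend-> π v N<i rewrite <ᵇ-false (<⇒≤ N<i) | <ᵇ-true N<i = refl

module _ {π N v} (π-perm : IsPermBelow N π) (v≤N : v ≤ N) where

  private
    π-inj = proj₁ (proj₁ π-perm)
    π-fix = proj₂ π-perm

    skip∘π≤N : ∀ {i} → i < N → skip v (π i) ≤ N
    skip∘π≤N {i} i<N = ≤-trans (skip-≤ v (π i)) (permBelow-< π-inj π-fix i i<N)

  extend-distinct : ∀ {i j} → i < j → extend π N v i ≢ extend π N v j
  extend-distinct {i} {j} i<j with <-cmp j N
  ... | tri< j<N _ _ rewrite extend-< π v (<-trans i<j j<N) | extend-< π v j<N =
    <⇒≢ i<j ∘ π-inj ∘ strictMono-injective (skip-strictMono v)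
  ... | tri≈ _ refl _ rewrite extend-< π v i<j | extend-last π N v = skip-≢ v (π i)
  ... | tri> _ _ N<j with <-cmp i N
  ... | tri< i<N _ _  rewrite extend-< π v i<N | extend-> π v N<j = <⇒≢ (≤-<-trans (skip∘π≤N i<N) N<j)
  ... | tri≈ _ refl _ rewrite extend-last π N v | extend-> π v N<j = <⇒≢ (≤-<-trans v≤N N<j)
  ... | tri> _ _ N<i  rewrite extend-> π v N<i | extend-> π v N<j = <⇒≢ i<j

  extend-onto : ∀ y → ∃ λ i → extend π N v i ≡ y
  extend-onto y with <-cmp y v
  ... | tri≈ _ refl _ = N , extend-last π N v
  ... | tri< y<v _ _ with permBelow-preimage (proj₁ π-perm) π-fix y (<-≤-trans y<v v≤N)
  ...   | i , i<N , refl = i , trans (extend-< π v i<N) (skip-< y<v)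
  extend-onto (suc y) | tri> _ _ v<1+y with y <? N
  ... | yes y<N with permBelow-preimage (proj₁ π-perm) π-fix y y<N
  ...   | i , i<N , refl = i , trans (extend-< π v i<N) (skip-≥ (≤-pred v<1+y))
  extend-onto (suc y) | tri> _ _ _ | no y≮N = suc y , extend-> π v (s≤s (≮⇒≥ y≮N))

  extend-permBelow : IsPermBelow (suc N) (extend π N v)
  extend-permBelow = (distinct⇒injective extend-distinct , extend-onto) , λ i → extend-> π v

fromFactoradic : (ℕ → ℕ) → ℕ → ℕ
fromFactoradic d M = ∑[ j < M ] (d j * j !)

fromFactoradic-suc : ∀ d M → fromFactoradic d (suc M) ≡ fromFactoradic d M + d M * M !
fromFactoradic-suc d M = ∑-suc M (λ j → d j * j !)

fromFactoradic-< : ∀ {d} M → (∀ j → d j ≤ j) → fromFactoradic d M < M !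
fromFactoradic-< zero    d≤ = s≤s z≤n
fromFactoradic-< {d} (suc M) d≤ = begin-strict
  fromFactoradic d (suc M)        ≡⟨ fromFactoradic-suc d M ⟩
  fromFactoradic d M + d M * M !  <⟨ +-monoˡ-< (d M * M !) (fromFactoradic-< M d≤) ⟩
  M ! + d M * M !                 ≤⟨ +-monoʳ-≤ (M !) (*-monoˡ-≤ (M !) (d≤ M)) ⟩
  M ! + M * M !                   ∎
  where open ≤-Reasoning

fromFactoradic-<-lex : ∀ {d e p} M → (∀ j → d j ≤ j) → p < M → d p < e p → (∀ j → p < j → d j ≡ e j) →
                       fromFactoradic d M < fromFactoradic e M
fromFactoradic-<-lex {d} {e} {p} (suc M) d≤ p<1+M dp<ep d≡e with m<1+n⇒m<n∨m≡n p<1+M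
... | inj₁ p<M = begin-strict
  fromFactoradic d (suc M)        ≡⟨ fromFactoradic-suc d M ⟩
  fromFactoradic d M + d M * M !  <⟨ +-monoˡ-< (d M * M !) (fromFactoradic-<-lex M d≤ p<M dp<ep d≡e) ⟩
  fromFactoradic e M + d M * M !  ≡⟨ cong (λ x → fromFactoradic e M + x * M !) (d≡e M p<M) ⟩
  fromFactoradic e M + e M * M !  ≡⟨ fromFactoradic-suc e M ⟨
  fromFactoradic e (suc M)        ∎
  where open ≤-Reasoning
... | inj₂ refl = begin-strict
  fromFactoradic d (suc p)        ≡⟨ fromFactoradic-suc d p ⟩
  fromFactoradic d p + d p * p !  <⟨ +-monoˡ-< (d p * p !) (fromFactoradic-< p d≤) ⟩
  suc (d p) * p !                 ≤⟨ *-monoˡ-≤ (p !) dp<ep ⟩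
  e p * p !                       ≤⟨ m≤n+m (e p * p !) (fromFactoradic e p) ⟩
  fromFactoradic e p + e p * p !  ≡⟨ fromFactoradic-suc e p ⟨
  fromFactoradic e (suc p)        ∎
  where open ≤-Reasoning

n∣m! : ∀ {n m} .{{_ : NonZero n}} → n ≤ m → n ∣ m !
n∣m! {suc n} n≤m = ∣-trans (m∣m*n (n !)) (m≤n⇒m!∣n! n≤m)

fromFactoradic-mod : ∀ d k .{{_ : NonZero k}} e → fromFactoradic d (k + e) % k ≡ fromFactoradic d k % k
fromFactoradic-mod d k zero    = cong (λ M → fromFactoradic d M % k) (+-identityʳ k)
fromFactoradic-mod d k (suc e) = begin
  fromFactoradic d (k + suc e) % k                          ≡⟨ cong (λ M → fromFactoradic d M % k) (+-suc k e) ⟩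
  fromFactoradic d (suc (k + e)) % k                        ≡⟨ cong (_% k) (fromFactoradic-suc d (k + e)) ⟩
  (fromFactoradic d (k + e) + d (k + e) * (k + e) !) % k    ≡⟨ %-remove-+ʳ _ k∣last-digit ⟩
  fromFactoradic d (k + e) % k                              ≡⟨ fromFactoradic-mod d k e ⟩
  fromFactoradic d k % k                                    ∎
  where
  open ≡-Reasoning
  k∣last-digit : k ∣ d (k + e) * (k + e) !
  k∣last-digit = ∣-trans (n∣m! (m≤m+n k e)) (n∣m*n (d (k + e)))

lehmer : (ℕ → ℕ) → ℕ → ℕ
lehmer σ j = ∑[ i < j ] inv σ i j

rank : (ℕ → ℕ) → ℕ → ℕ
rank σ = fromFactoradic (lehmer σ)

lehmer-≤ : ∀ σ j → lehmer σ j ≤ j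
lehmer-≤ σ j =
  subst (lehmer σ j ≤_) (length-upTo j) (sum-map-≤-length (λ i → 𝟙[<]≤1 (σ j) (σ i)) (upTo j))

invSum≡rank : ∀ σ k → invSum σ k ≡ rank σ k
invSum≡rank σ k = cong sum (map-cong (λ j → sum-map-*ʳ (λ i → inv σ i j) (j !) (upTo j)) (upTo k))

rank-cong : ∀ {σ τ} N → σ ≐ τ → rank σ N ≡ rank τ N
rank-cong N σ≐τ = ∑-cong N (λ j _ → cong (_* j !) (∑-cong j (λ i _ → cong₂ 𝟙[_<_] (σ≐τ j) (σ≐τ i))))

lehmer-agree : ∀ {τ ρ j} → Injective _≡_ _≡_ τ → Onto ρ → AgreeFrom j τ ρ → lehmer τ j ≡ lehmer ρ j
lehmer-agree {τ} {ρ} {j} τ-inj ρ-onto τ≡ρ = begin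
  ∑[ i < j ] 𝟙[ τ j < τ i ]  ≡⟨ cong (λ x → ∑[ i < j ] 𝟙[ x < τ i ]) (τ≡ρ j ≤-refl) ⟩
  ∑[ i < j ] 𝟙[ ρ j < τ i ]  ≡⟨ ∑-reindex j (λ x → 𝟙[ ρ j < x ]) τ-inj (agreeFrom⇒image⊆ τ-inj ρ-onto τ≡ρ) ⟩
  ∑[ i < j ] 𝟙[ ρ j < ρ i ]  ∎
  where open ≡-Reasoning

-- On positions ≤ p, τ and ρ take the same set of values; counting those above ρ p,
-- τ additionally sees its own value τ p.
lehmer-< : ∀ {τ ρ p} → Injective _≡_ _≡_ ρ → Onto τ → AgreeFrom (suc p) τ ρ → ρ p < τ p →
           lehmer τ p < lehmer ρ p
lehmer-< {τ} {ρ} {p} ρ-inj τ-onto τ≡ρ ρp<τp = begin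
  suc (lehmer τ p)                            ≡⟨ +-comm 1 (lehmer τ p) ⟩
  lehmer τ p + 1                              ≤⟨ +-monoˡ-≤ 1 (sum-map-mono-≤ above-τp≤above-ρp (upTo p)) ⟩
  ∑[ i < p ] 𝟙[ ρ p < τ i ] + 1               ≡⟨ cong (∑[ i < p ] 𝟙[ ρ p < τ i ] +_) (𝟙[<]-yes ρp<τp) ⟨
  ∑[ i < p ] 𝟙[ ρ p < τ i ] + 𝟙[ ρ p < τ p ]  ≡⟨ ∑-suc p (λ i → 𝟙[ ρ p < τ i ]) ⟨
  ∑[ i < suc p ] 𝟙[ ρ p < τ i ]               ≡⟨ ∑-reindex (suc p) (λ x → 𝟙[ ρ p < x ]) ρ-inj ρ⊆τ ⟨
  ∑[ i < suc p ] 𝟙[ ρ p < ρ i ]               ≡⟨ ∑-suc p (λ i → 𝟙[ ρ p < ρ i ]) ⟩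
  lehmer ρ p + 𝟙[ ρ p < ρ p ]                 ≡⟨ cong (lehmer ρ p +_) (𝟙[<]-no (≤-refl {ρ p})) ⟩
  lehmer ρ p + 0                              ≡⟨ +-identityʳ (lehmer ρ p) ⟩
  lehmer ρ p                                  ∎
  where
  open ≤-Reasoning
  above-τp≤above-ρp : ∀ i → 𝟙[ τ p < τ i ] ≤ 𝟙[ ρ p < τ i ]
  above-τp≤above-ρp i = 𝟙[<]-antitoneˡ (τ i) (<⇒≤ ρp<τp)
  ρ⊆τ = agreeFrom⇒image⊆ ρ-inj τ-onto (λ q p<q → sym (τ≡ρ q p<q))

rank-strictMono : ∀ {N τ ρ} → IsPermBelow N τ → IsPermBelow N ρ → τ ≺ ρ → rank τ N < rank ρ N
rank-strictMono {N} {τ} {ρ} ((τ-inj , τ-onto) , τ-fix) ((ρ-inj , ρ-onto) , ρ-fix) (p , ρp<τp , τ≡ρ) =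
  fromFactoradic-<-lex N (lehmer-≤ τ) p<N (lehmer-< ρ-inj τ-onto τ≡ρ ρp<τp) higher-digits≡
  where
  p<N : p < N
  p<N with p <? N
  ... | yes p<N = p<N
  ... | no  p≮N = ⊥-elim (<-irrefl (trans (ρ-fix p (≮⇒≥ p≮N)) (sym (τ-fix p (≮⇒≥ p≮N)))) ρp<τp)
  higher-digits≡ : ∀ j → p < j → lehmer τ j ≡ lehmer ρ j
  higher-digits≡ j p<j = lehmer-agree τ-inj ρ-onto (λ q j≤q → τ≡ρ q (<-≤-trans p<j j≤q))

≺-trichotomy : ∀ {τ ρ} m → AgreeFrom m τ ρ → τ ≐ ρ ⊎ τ ≺ ρ ⊎ ρ ≺ τ
≺-trichotomy zero τ≡ρ = inj₁ (λ q → τ≡ρ q z≤n)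
≺-trichotomy {τ} {ρ} (suc m) τ≡ρ with <-cmp (τ m) (ρ m)
... | tri< τm<ρm _ _ = inj₂ (inj₂ (m , τm<ρm , λ q m<q → sym (τ≡ρ q m<q)))
... | tri> _ _ ρm<τm = inj₂ (inj₁ (m , ρm<τm , τ≡ρ))
... | tri≈ _ τm≡ρm _ = ≺-trichotomy m τ≡ρ′
  where
  τ≡ρ′ : AgreeFrom m τ ρ
  τ≡ρ′ q m≤q with m≤n⇒m<n∨m≡n m≤q
  ... | inj₁ m<q  = τ≡ρ q m<q
  ... | inj₂ refl = τm≡ρm

module _ {N τ ρ} (τ-perm : IsPermBelow N τ) (ρ-perm : IsPermBelow N ρ) where

  private
    trichotomy : τ ≐ ρ ⊎ τ ≺ ρ ⊎ ρ ≺ τ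
    trichotomy = ≺-trichotomy N (λ q N≤q → trans (proj₂ τ-perm q N≤q) (sym (proj₂ ρ-perm q N≤q)))

  rank-injective : rank τ N ≡ rank ρ N → τ ≐ ρ
  rank-injective eq with trichotomy
  ... | inj₁ τ≐ρ        = τ≐ρ
  ... | inj₂ (inj₁ τ≺ρ) = ⊥-elim (<-irrefl eq (rank-strictMono τ-perm ρ-perm τ≺ρ))
  ... | inj₂ (inj₂ ρ≺τ) = ⊥-elim (<-irrefl (sym eq) (rank-strictMono ρ-perm τ-perm ρ≺τ))

  rank-reflects-≺ : rank τ N < rank ρ N → τ ≺ ρ
  rank-reflects-≺ lt with trichotomy
  ... | inj₁ τ≐ρ        = ⊥-elim (<-irrefl (rank-cong N τ≐ρ) lt)
  ... | inj₂ (inj₁ τ≺ρ) = τ≺ρ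
  ... | inj₂ (inj₂ ρ≺τ) = ⊥-elim (<-asym lt (rank-strictMono ρ-perm τ-perm ρ≺τ))

-- The last digit m / N! of m is the number of earlier values above the one placed at N.
decode : ℕ → ℕ → ℕ → ℕ
decode zero    m = id
decode (suc N) m = extend (decode N (m % N !)) N (N ∸ m / N !)
  where instance N!≢0 = N !≢0

decode-permBelow : ∀ N m → IsPermBelow N (decode N m)
decode-permBelow zero    m = (id , λ y → y , refl) , λ _ _ → refl
decode-permBelow (suc N) m = extend-permBelow (decode-permBelow N (m % N !)) (m∸n≤m N (m / N !))
  where instance N!≢0 = N !≢0

lehmer-extend-< : ∀ π {N} v {j} → j < N → lehmer (extend π N v) j ≡ lehmer π j
lehmer-extend-< π {N} v {j} j<N = ∑-cong j λ i i<j → begin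
  𝟙[ extend π N v j < extend π N v i ]  ≡⟨ cong₂ 𝟙[_<_] (extend-< π v j<N) (extend-< π v (<-trans i<j j<N)) ⟩
  𝟙[ skip v (π j) < skip v (π i) ]      ≡⟨ 𝟙[<]-strictMono (skip-strictMono v) (π j) (π i) ⟩
  𝟙[ π j < π i ]                        ∎
  where open ≡-Reasoning

lehmer-extend-last : ∀ {π N} v → IsPermBelow N π → lehmer (extend π N v) N ≡ N ∸ v
lehmer-extend-last {π} {N} v ((π-inj , _) , π-fix) = begin
  ∑[ i < N ] 𝟙[ extend π N v N < extend π N v i ]
    ≡⟨ ∑-cong N (λ i i<N → cong₂ 𝟙[_<_] (extend-last π N v) (extend-< π v i<N)) ⟩
  ∑[ i < N ] 𝟙[ v < skip v (π i) ]
    ≡⟨ ∑-reindex N (λ x → 𝟙[ v < skip v x ]) π-inj (agreeFrom⇒image⊆ π-inj (λ y → y , refl) π-fix) ⟩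
  ∑[ x < N ] 𝟙[ v < skip v x ]
    ≡⟨ ∑-𝟙[<skip] v N ⟩
  N ∸ v
    ∎
  where open ≡-Reasoning

rank-decode : ∀ N m → m < N ! → rank (decode N m) N ≡ m
rank-decode zero    zero    _         = refl
rank-decode zero    (suc m) (s≤s ())
rank-decode (suc N) m       m<[1+N]! = begin
  rank π′ (suc N)                ≡⟨ fromFactoradic-suc (lehmer π′) N ⟩
  rank π′ N + lehmer π′ N * N !  ≡⟨ cong₂ (λ r d → r + d * N !) rank-π′≡rank-π (lehmer-extend-last v π-perm) ⟩
  rank π N + (N ∸ v) * N !       ≡⟨ cong₂ (λ r d → r + d * N !) (rank-decode N (m % N !) (m%n<n m (N !)))
                                          (m∸[m∸n]≡n (≤-pred (m<n*o⇒m/o<n m<[1+N]!))) ⟩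
  m % N ! + m / N ! * N !        ≡⟨ m≡m%n+[m/n]*n m (N !) ⟨
  m                              ∎
  where
  open ≡-Reasoning
  instance N!≢0 = N !≢0
  π = decode N (m % N !)
  π-perm = decode-permBelow N (m % N !)
  v = N ∸ m / N !
  π′ = extend π N v
  rank-π′≡rank-π : rank π′ N ≡ rank π N
  rank-π′≡rank-π = ∑-cong N (λ j j<N → cong (_* j !) (lehmer-extend-< π v j<N))

permBelow⇒tame : ∀ {N π} → IsPermBelow N π → IsTame π
permBelow⇒tame {N} (π-perm , π-fix) = π-perm , N , π-fix

-- If the largest differing position p were ≥ N, then τ p > σ p = p would be a
-- second preimage of τ p under τ.
≺-fixesFrom : ∀ {σ τ N} → Injective _≡_ _≡_ τ → FixesFrom N σ → τ ≺ σ → FixesFrom N τ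
≺-fixesFrom {σ} {τ} {N} τ-inj σ-fix (p , σp<τp , τ≡σ) q N≤q =
  trans (τ≡σ q (<-≤-trans p<N N≤q)) (σ-fix q N≤q)
  where
  p<N : p < N
  p<N with p <? N
  ... | yes p<N = p<N
  ... | no  p≮N = ⊥-elim (<⇒≢ p<τp (sym (τ-inj τ[τp]≡τp)))
    where
    N≤p = ≮⇒≥ p≮N
    p<τp : p < τ p
    p<τp = subst (_< τ p) (σ-fix p N≤p) σp<τp
    τ[τp]≡τp : τ (τ p) ≡ τ p
    τ[τp]≡τp = trans (τ≡σ (τ p) p<τp) (σ-fix (τ p) (≤-trans N≤p (<⇒≤ p<τp)))

module _ {σ n N} (σ-form : IsFactoradicFormOf σ n) (σ-fix : FixesFrom N σ) where

  private
    σ-permBelow : IsPermBelow N σ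
    σ-permBelow = proj₁ (proj₁ σ-form) , σ-fix

    predecessors = proj₂ σ-form
    f            = proj₁ predecessors
    f-below      = proj₁ (proj₂ predecessors)
    f-injective  = proj₁ (proj₂ (proj₂ predecessors))
    f-onto       = proj₂ (proj₂ (proj₂ predecessors))

  predecessors≤rank : n ≤ rank σ N
  predecessors≤rank = injective⇒≤ toRank-injective
    where
    f-permBelow : ∀ a → IsPermBelow N (f a)
    f-permBelow a = τ-perm , ≺-fixesFrom (proj₁ τ-perm) σ-fix τ≺σ
      where τ-perm = proj₁ (proj₁ (f-below a)); τ≺σ = proj₂ (f-below a)

    rank-f< : ∀ a → rank (f a) N < rank σ N
    rank-f< a = rank-strictMono (f-permBelow a) σ-permBelow (proj₂ (f-below a))

    toRank : Fin n → Fin (rank σ N)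
    toRank a = fromℕ< (rank-f< a)

    toRank-injective : Injective _≡_ _≡_ toRank
    toRank-injective {a} {b} eq = f-injective a b (rank-injective (f-permBelow a) (f-permBelow b) (begin
      rank (f a) N    ≡⟨ toℕ-fromℕ< (rank-f< a) ⟨
      toℕ (toRank a)  ≡⟨ cong toℕ eq ⟩
      toℕ (toRank b)  ≡⟨ toℕ-fromℕ< (rank-f< b) ⟩
      rank (f b) N    ∎))
      where open ≡-Reasoning

  rank≤predecessors : rank σ N ≤ n
  rank≤predecessors = injective⇒≤ fromRank-injective
    where
    decoded : Fin (rank σ N) → ℕ → ℕ
    decoded m = decode N (toℕ m)

    rank-decoded : ∀ m → rank (decoded m) N ≡ toℕ m
    rank-decoded m = rank-decode N (toℕ m) (<-trans (toℕ<n m) (fromFactoradic-< N (lehmer-≤ σ)))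

    decoded≺σ : ∀ m → decoded m ≺ σ
    decoded≺σ m = rank-reflects-≺ (decode-permBelow N (toℕ m)) σ-permBelow
                    (subst (_< rank σ N) (sym (rank-decoded m)) (toℕ<n m))

    covered : ∀ m → ∃ λ a → f a ≐ decoded m
    covered m = f-onto (decoded m) (permBelow⇒tame (decode-permBelow N (toℕ m))) (decoded≺σ m)

    fromRank : Fin (rank σ N) → Fin n
    fromRank m = proj₁ (covered m)

    fromRank-injective : Injective _≡_ _≡_ fromRank
    fromRank-injective {m} {m′} eq = toℕ-injective (begin
      toℕ m                     ≡⟨ rank-decoded m ⟨
      rank (decoded m) N        ≡⟨ rank-cong N (proj₂ (covered m)) ⟨
      rank (f (fromRank m)) N   ≡⟨ cong (λ a → rank (f a) N) eq ⟩
      rank (f (fromRank m′)) N  ≡⟨ rank-cong N (proj₂ (covered m′)) ⟩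
      rank (decoded m′) N       ≡⟨ rank-decoded m′ ⟩
      toℕ m′                    ∎)
      where open ≡-Reasoning

  factoradicForm≡rank : n ≡ rank σ N
  factoradicForm≡rank = ≤-antisym predecessors≤rank rank≤predecessors

corollary3p4 : (n k : ℕ) .{{_ : NonZero k}} (σ : ℕ → ℕ) →
    IsFactoradicFormOf σ n → n % k ≡ invSum σ k % k
corollary3p4 n k σ σ-form@((_ , N , σ-fix) , _) = begin
  n % k               ≡⟨ cong (_% k) (factoradicForm≡rank σ-form σ-fix′) ⟩
  rank σ (k + N) % k  ≡⟨ fromFactoradic-mod (lehmer σ) k N ⟩
  rank σ k % k        ≡⟨ cong (_% k) (invSum≡rank σ k) ⟨
  invSum σ k % k      ∎
  where
  open ≡-Reasoning
  σ-fix′ : FixesFrom (k + N) σ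
  σ-fix′ q k+N≤q = σ-fix q (≤-trans (m≤n+m N k) k+N≤q)
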